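{- For every graph $G$ and every integer $n>1$, \[H_n(G)\,\overline{H_n(G)} \leq n!/2.\]
   Context: Two graphs on the same vertex set are called $G$-creating if the union of their edge sets contains $G$ as a (not necessarily induced) subgraph. $H_n(G)$ denotes the maximum number of Hamiltonian paths of the complete graph $K_n$ that are pairwise $G$-creating, and $\overline{H_n(G)}$ denotes the maximum number of Hamiltonian paths of $K_n$ that are pairwise non-$G$-creating (i.e., no two of them are $G$-creating). -}

module Defs where

open import Data.Nat using (ℕ; suc)
open import Data.Fin using (Fin; toℕ)
open import Data.Product using (Σ; _×_)
open import Data.Sum using (_⊎_)
open import Data.Empty using (⊥)
open import Relation.Nullary using (¬_)
open import Relation.Binary.PropositionalEquality using (_≡_)
open import Function.Definitions using (Injective)

record Graph : Set₁ where
  field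
    size  : ℕ
    Adj   : Fin size → Fin size → Set
    sym   : ∀ {u v} → Adj u v → Adj v u
    irrefl : ∀ {u} → Adj u u → ⊥

open Graph public

-- A Hamiltonian path of K_n, given by its vertex sequence seq 0, …, seq (n-1)
-- (an injective, hence bijective, map Fin n → Fin n).
record HamPath (n : ℕ) : Set where
  field
    seq : Fin n → Fin n
    inj : Injective _≡_ _≡_ seq

open HamPath public

PEdge : ∀ {n} → HamPath n → Fin n → Fin n → Set
PEdge P x y =
  Σ (Fin _) λ i → Σ (Fin _) λ j → suc (toℕ i) ≡ toℕ j ×
    ((seq P i ≡ x × seq P j ≡ y) ⊎ (seq P i ≡ y × seq P j ≡ x))

-- Two vertex sequences describe the same Hamiltonian path (same edge set,
-- i.e. equal or reversed sequences).
SamePath : ∀ {n} → HamPath n → HamPath n → Set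
SamePath P Q = ∀ x y → (PEdge P x y → PEdge Q x y) × (PEdge Q x y → PEdge P x y)

-- P and Q are G-creating: the union of their edge sets contains a copy of G
-- (an injective vertex map sending edges of G to edges of P ∪ Q).
Creating : ∀ {n} → Graph → HamPath n → HamPath n → Set
Creating {n} G P Q =
  Σ (Fin (size G) → Fin n) λ f → Injective _≡_ _≡_ f ×
    (∀ u v → Adj G u v → PEdge P (f u) (f v) ⊎ PEdge Q (f u) (f v))

NonCreating : ∀ {n} → Graph → HamPath n → HamPath n → Set
NonCreating G P Q = ¬ Creating G P Q

Distinct : ∀ {n} → HamPath n → HamPath n → Set
Distinct P Q = ¬ SamePath P Q

module Submission where

-- Lemma 3.1:  H_n(G) · H̄_n(G) ≤ n!/2  for every graph G and n > 1.
-- Let A be a family of pairwise distinct, pairwise G-creating Hamiltonian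
-- paths and B a family of pairwise distinct, pairwise non-G-creating ones.
-- For a ∈ A, b ∈ B and an orientation c ∈ {forward, backward} let
-- carry(a,b,c) be the permutation of the vertices sending the i-th vertex of
-- a to the i-th vertex of b read in orientation c.  Relabelling a by
-- carry(a,b,c) gives b.  The map (a,b,c) ↦ carry(a,b,c) is injective:
-- if one permutation σ carries a to b and a' to b', then σ transports the
-- relations between a, a' to b, b'; so a ≠ a' would make b, b' G-creating
-- (forcing b = b') and then a = a'; with a = a', distinctness in B gives
-- b = b'; and since n > 1 the two orientations of b start at different
-- vertices, so c is determined.  Hence 2·|A|·|B| ≤ #permutations ≤ n!.

open import Defs hiding (sym)
open import Data.Nat using (ℕ; zero; suc; _*_; _∸_; _≤_; _<_; _/_; _!; s≤s; NonZero)
open import Data.Nat.Properties using (1+n≰n; *-assoc; +-∸-assoc)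
open import Data.Nat.DivMod using (m*n/n≡m; /-monoˡ-≤)
open import Data.Fin using (Fin; zero; suc; toℕ; punchOut; punchIn; combine; remQuot; opposite)
open import Data.Fin.Properties
  using (0≢1+n; suc-injective; any?; injective⇒≤; punchOut-injective; punchIn-punchOut;
         combine-injective; combine-remQuot; toℕ<n; opposite-prop; opposite-involutive)
  renaming (_≟_ to _≟ᶠ_)
open import Data.List using (List; length; lookup)
open import Data.List.Relation.Unary.All using (All; _∷_)
open import Data.List.Relation.Unary.AllPairs using (AllPairs; _∷_)
open import Data.Product using (∃; _×_; _,_; proj₁; proj₂; uncurry; map₂)
open import Data.Product.Properties using (,-injectiveˡ; ,-injectiveʳ)
import Data.Product as Product
open import Data.Sum using (_⊎_; inj₁; inj₂; [_,_]′)
import Data.Sum as Sum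
open import Data.Empty using (⊥-elim)
open import Relation.Nullary using (yes; no; contradiction)
open import Relation.Binary.PropositionalEquality
open import Function using (_∘_)
open import Function.Definitions using (Injective)

Inj : ∀ {m n} → (Fin m → Fin n) → Set
Inj f = Injective _≡_ _≡_ f

dropHead : ∀ {m n} (f : Fin (suc m) → Fin (suc n)) → Inj f → Fin m → Fin n
dropHead f f-inj i = punchOut {i = f zero} {j = f (suc i)} (λ eq → 0≢1+n (f-inj eq))

dropHead-injective : ∀ {m n} (f : Fin (suc m) → Fin (suc n)) (f-inj : Inj f) →
  Inj (dropHead f f-inj)
dropHead-injective f f-inj eq = suc-injective (f-inj (punchOut-injective {i = f zero} _ _ eq))

dropHead-restore : ∀ {m n} (f : Fin (suc m) → Fin (suc n)) (f-inj : Inj f) (i : Fin m) →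
  punchIn (f zero) (dropHead f f-inj i) ≡ f (suc i)
dropHead-restore f f-inj i = punchIn-punchOut _

code : ∀ {n} (f : Fin n → Fin n) → Inj f → Fin (n !)
code {zero}  f f-inj = zero
code {suc n} f f-inj = combine (f zero) (code (dropHead f f-inj) (dropHead-injective f f-inj))

code-injective : ∀ {n} (f g : Fin n → Fin n) (f-inj : Inj f) (g-inj : Inj g) →
  code f f-inj ≡ code g g-inj → f ≗ g
code-injective {zero}  f g f-inj g-inj eq ()
code-injective {suc n} f g f-inj g-inj eq = agree
  where
  parts = combine-injective (f zero) _ (g zero) _ eq
  heads : f zero ≡ g zero
  heads = proj₁ parts
  tails : dropHead f f-inj ≗ dropHead g g-inj
  tails = code-injective _ _ _ _ (proj₂ parts)
  agree : f ≗ g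
  agree zero    = heads
  agree (suc i) = begin
    f (suc i)                                 ≡⟨ sym (dropHead-restore f f-inj i) ⟩
    punchIn (f zero) (dropHead f f-inj i)     ≡⟨ cong₂ punchIn heads (tails i) ⟩
    punchIn (g zero) (dropHead g g-inj i)     ≡⟨ dropHead-restore g g-inj i ⟩
    g (suc i)                                 ∎
    where open ≡-Reasoning

-- Pigeonhole: an injective self-map of Fin n is onto, since a map
-- missing a value y would inject Fin n into Fin n ∖ {y}.
injective⇒onto : ∀ {n} (f : Fin n → Fin n) → Inj f → ∀ y → ∃ λ x → f x ≡ y
injective⇒onto {zero}  f f-inj ()
injective⇒onto {suc m} f f-inj y with any? (λ x → f x ≟ᶠ y)
... | yes hit = hit
... | no miss = contradiction (injective⇒≤ avoid-injective) 1+n≰n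
  where
  avoid : Fin (suc m) → Fin m
  avoid x = punchOut {i = y} {j = f x} (λ eq → miss (x , sym eq))
  avoid-injective : Inj avoid
  avoid-injective eq = f-inj (punchOut-injective {i = y} _ _ eq)

-- The inverse is kept abstract: it is used only through its defining
-- property, and unfolding the pigeonhole search inside it during type
-- checking of the later lemmas is prohibitively expensive.
abstract
  inverse : ∀ {n} (f : Fin n → Fin n) → Inj f → Fin n → Fin n
  inverse f f-inj y = proj₁ (injective⇒onto f f-inj y)

  inverse-right : ∀ {n} (f : Fin n → Fin n) (f-inj : Inj f) y → f (inverse f f-inj y) ≡ y
  inverse-right f f-inj y = proj₂ (injective⇒onto f f-inj y)

inverse-left : ∀ {n} (f : Fin n → Fin n) (f-inj : Inj f) x → inverse f f-inj (f x) ≡ x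
inverse-left f f-inj x = f-inj (inverse-right f f-inj (f x))

inverse-injective : ∀ {n} (f : Fin n → Fin n) (f-inj : Inj f) → Inj (inverse f f-inj)
inverse-injective f f-inj {x} {y} eq = begin
  x                       ≡⟨ sym (inverse-right f f-inj x) ⟩
  f (inverse f f-inj x)   ≡⟨ cong f eq ⟩
  f (inverse f f-inj y)   ≡⟨ inverse-right f f-inj y ⟩
  y                       ∎
  where open ≡-Reasoning

remQuot-injective : ∀ {m} n → Injective _≡_ _≡_ (remQuot {m} n)
remQuot-injective {m} n {i} {j} eq = begin
  i                                    ≡⟨ sym (combine-remQuot {m} n i) ⟩
  uncurry combine (remQuot {m} n i)    ≡⟨ cong (uncurry combine) eq ⟩
  uncurry combine (remQuot {m} n j)    ≡⟨ combine-remQuot {m} n j ⟩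
  j                                    ∎
  where open ≡-Reasoning

triple-injection-bound : ∀ {a b c d} (f : Fin a × Fin b × Fin c → Fin d) →
  Injective _≡_ _≡_ f → a * (b * c) ≤ d
triple-injection-bound {a} {b} {c} f f-inj =
  injective⇒≤ {f = f ∘ map₂ (remQuot {b} c) ∘ remQuot {a} (b * c)} flat-injective
  where
  flat-injective : Inj (f ∘ map₂ (remQuot {b} c) ∘ remQuot {a} (b * c))
  flat-injective eq =
    let same = f-inj eq in
    remQuot-injective {a} (b * c)
      (cong₂ _,_ (,-injectiveˡ same) (remQuot-injective {b} c (,-injectiveʳ same)))

*-bound⇒≤/ : ∀ {m n} k .{{_ : NonZero k}} → m * k ≤ n → m ≤ n / k
*-bound⇒≤/ {m} {n} k mk≤n = subst (_≤ n / k) (m*n/n≡m m k) (/-monoˡ-≤ k mk≤n)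

relabel : ∀ {n} (σ : Fin n → Fin n) → Inj σ → HamPath n → HamPath n
relabel σ σ-inj P = record { seq = σ ∘ seq P ; inj = λ eq → inj P (σ-inj eq) }

relabel-edge : ∀ {n} (σ : Fin n → Fin n) (σ-inj : Inj σ) (P : HamPath n) {x y} →
  PEdge P x y → PEdge (relabel σ σ-inj P) (σ x) (σ y)
relabel-edge σ σ-inj P (i , j , ij , ends) =
  i , j , ij , Sum.map (Product.map (cong σ) (cong σ)) (Product.map (cong σ) (cong σ)) ends

unrelabel-edge : ∀ {n} (σ : Fin n → Fin n) (σ-inj : Inj σ) (P : HamPath n) {x y} →
  PEdge (relabel σ σ-inj P) (σ x) (σ y) → PEdge P x y
unrelabel-edge σ σ-inj P (i , j , ij , ends) =
  i , j , ij , Sum.map (Product.map σ-inj σ-inj) (Product.map σ-inj σ-inj) ends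

Consecutive : ∀ {n} → Fin n → Fin n → Set
Consecutive i j = suc (toℕ i) ≡ toℕ j

reindex-edge : ∀ {n} {P Q : HamPath n} (ρ : Fin n → Fin n) →
  (∀ {i j} → Consecutive i j → Consecutive (ρ i) (ρ j) ⊎ Consecutive (ρ j) (ρ i)) →
  (∀ i → seq Q (ρ i) ≡ seq P i) → ∀ {x y} → PEdge P x y → PEdge Q x y
reindex-edge {P = P} {Q} ρ ρ-consecutive along {x} {y} (i , j , ij , ends) =
  [ (λ forward → ρ i , ρ j , forward , moved) ,
    (λ backward → ρ j , ρ i , backward ,
                  Sum.swap (Sum.map Product.swap Product.swap moved)) ]′
  (ρ-consecutive ij)
  where
  moved : (seq Q (ρ i) ≡ x × seq Q (ρ j) ≡ y) ⊎ (seq Q (ρ i) ≡ y × seq Q (ρ j) ≡ x)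
  moved = Sum.map (Product.map (trans (along i)) (trans (along j)))
                  (Product.map (trans (along i)) (trans (along j))) ends

opposite-consecutive : ∀ {n} {i j : Fin n} →
  Consecutive i j → Consecutive (opposite j) (opposite i)
opposite-consecutive {n} {i} {j} ij = begin
  suc (toℕ (opposite j))    ≡⟨ cong suc (opposite-prop j) ⟩
  suc (n ∸ suc (toℕ j))     ≡⟨ sym (+-∸-assoc 1 (toℕ<n j)) ⟩
  n ∸ toℕ j                 ≡⟨ cong (n ∸_) (sym ij) ⟩
  n ∸ suc (toℕ i)           ≡⟨ sym (opposite-prop i) ⟩
  toℕ (opposite i)          ∎
  where open ≡-Reasoning

orient : ∀ {n} → Fin 2 → Fin n → Fin n
orient zero    i = i
orient (suc _) i = opposite i

orient-involutive : ∀ {n} c (i : Fin n) → orient c (orient c i) ≡ i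
orient-involutive zero    i = refl
orient-involutive (suc _) i = opposite-involutive i

orient-consecutive : ∀ {n} c {i j : Fin n} →
  Consecutive i j →
  Consecutive (orient c i) (orient c j) ⊎ Consecutive (orient c j) (orient c i)
orient-consecutive zero    ij = inj₁ ij
orient-consecutive (suc _) ij = inj₂ (opposite-consecutive ij)

orient-start : ∀ {m} c c' → orient {suc (suc m)} c zero ≡ orient c' zero → c ≡ c'
orient-start zero          zero          _ = refl
orient-start (suc zero)    (suc zero)    _ = refl
orient-start zero          (suc zero)    ()
orient-start (suc zero)    zero          ()

same-refl : ∀ {n} {P : HamPath n} → SamePath P P
same-refl x y = (λ e → e) , (λ e → e)

same-sym : ∀ {n} (P Q : HamPath n) → SamePath P Q → SamePath Q P
same-sym P Q PQ x y = Product.swap (PQ x y)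

same-trans : ∀ {n} (P Q R : HamPath n) → SamePath P Q → SamePath Q R → SamePath P R
same-trans P Q R PQ QR x y =
  proj₁ (QR x y) ∘ proj₁ (PQ x y) , proj₂ (PQ x y) ∘ proj₂ (QR x y)

same-by-orientation : ∀ {n} {P Q : HamPath n} c →
  (∀ i → seq Q (orient c i) ≡ seq P i) → SamePath P Q
same-by-orientation {P = P} {Q} c along x y =
  reindex-edge {P = P} {Q} (orient c) (orient-consecutive c) along ,
  reindex-edge {P = Q} {P} (orient c) (orient-consecutive c) back
  where
  back : ∀ i → seq P (orient c i) ≡ seq Q i
  back i = trans (sym (along (orient c i))) (cong (seq Q) (orient-involutive c i))

same-unrelabel : ∀ {n} (σ : Fin n → Fin n) (σ-inj : Inj σ) {P Q : HamPath n} →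
  SamePath (relabel σ σ-inj P) (relabel σ σ-inj Q) → SamePath P Q
same-unrelabel σ σ-inj {P} {Q} same x y =
  unrelabel-edge σ σ-inj Q ∘ proj₁ (same (σ x) (σ y)) ∘ relabel-edge σ σ-inj P ,
  unrelabel-edge σ σ-inj P ∘ proj₂ (same (σ x) (σ y)) ∘ relabel-edge σ σ-inj Q

distinct-sym : ∀ {n} (P Q : HamPath n) → Distinct P Q → Distinct Q P
distinct-sym P Q P≢Q = P≢Q ∘ same-sym Q P

creating-sym : ∀ {n} G (P Q : HamPath n) → Creating G P Q → Creating G Q P
creating-sym G P Q (f , f-inj , covers) = f , f-inj , λ u v adj → Sum.swap (covers u v adj)

creating-resp-same : ∀ {n} G {P Q P' Q' : HamPath n} → SamePath P P' → SamePath Q Q' →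
  Creating G P Q → Creating G P' Q'
creating-resp-same G PP' QQ' (f , f-inj , covers) =
  f , f-inj , λ u v adj → Sum.map (proj₁ (PP' _ _)) (proj₁ (QQ' _ _)) (covers u v adj)

creating-relabel : ∀ {n} G (σ : Fin n → Fin n) (σ-inj : Inj σ) {P Q : HamPath n} →
  Creating G P Q → Creating G (relabel σ σ-inj P) (relabel σ σ-inj Q)
creating-relabel G σ σ-inj {P} {Q} (f , f-inj , covers) =
  σ ∘ f , f-inj ∘ σ-inj ,
  λ u v adj → Sum.map (relabel-edge σ σ-inj P) (relabel-edge σ σ-inj Q) (covers u v adj)

nonCreating-sym : ∀ {n} G (P Q : HamPath n) → NonCreating G P Q → NonCreating G Q P
nonCreating-sym G P Q noPQ = noPQ ∘ creating-sym G Q P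

creating-carried : ∀ {n} G (σ : Fin n → Fin n) (σ-inj : Inj σ) {P P' R R' : HamPath n} →
  SamePath (relabel σ σ-inj P) R → SamePath (relabel σ σ-inj P') R' →
  Creating G P P' → Creating G R R'
creating-carried G σ σ-inj {P} {P'} {R} {R'} P↦R P'↦R' creating =
  creating-resp-same G {relabel σ σ-inj P} {relabel σ σ-inj P'} {R} {R'} P↦R P'↦R'
    (creating-relabel G σ σ-inj {P} {P'} creating)

same-carried : ∀ {n} (σ : Fin n → Fin n) (σ-inj : Inj σ) {P P' R R' : HamPath n} →
  SamePath (relabel σ σ-inj P) R → SamePath (relabel σ σ-inj P') R' →
  SamePath R R' → SamePath P P'
same-carried σ σ-inj {P} {P'} {R} {R'} P↦R P'↦R' RR' =
  same-unrelabel σ σ-inj {P} {P'}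
    (same-trans (relabel σ σ-inj P) R (relabel σ σ-inj P') P↦R
      (same-trans R R' (relabel σ σ-inj P') RR' (same-sym (relabel σ σ-inj P') R' P'↦R')))

carry : ∀ {n} (P Q : HamPath n) → Fin 2 → Fin n → Fin n
carry P Q c = seq Q ∘ orient c ∘ inverse (seq P) (inj P)

carry-injective : ∀ {n} (P Q : HamPath n) c → Inj (carry P Q c)
carry-injective P Q c =
  inverse-injective (seq P) (inj P) ∘ orient-injective ∘ inj Q
  where
  orient-injective : ∀ {i j} → orient c i ≡ orient c j → i ≡ j
  orient-injective {i} {j} eq =
    trans (sym (orient-involutive c i)) (trans (cong (orient c) eq) (orient-involutive c j))

carry-sends : ∀ {n} (P Q : HamPath n) c i → carry P Q c (seq P i) ≡ seq Q (orient c i)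
carry-sends P Q c i = cong (seq Q ∘ orient c) (inverse-left (seq P) (inj P) i)

carried-onto : ∀ {n} {σ : Fin n → Fin n} {σ-inj : Inj σ} (P Q : HamPath n) c →
  σ ≗ carry P Q c → SamePath (relabel σ σ-inj P) Q
carried-onto {σ = σ} {σ-inj} P Q c σ≗carry =
  same-by-orientation {P = relabel σ σ-inj P} {Q} c
    (λ i → sym (trans (σ≗carry (seq P i)) (carry-sends P Q c i)))

-- With at least two vertices the orientation is determined too, since the
-- two orientations of Q start at different vertices.
carry-determines-orientation : ∀ {m} (P Q : HamPath (suc (suc m))) {c c'} →
  carry P Q c ≗ carry P Q c' → c ≡ c'
carry-determines-orientation P Q {c} {c'} agree = orient-start c c' (inj Q (begin
  seq Q (orient c zero)        ≡⟨ sym (carry-sends P Q c zero) ⟩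
  carry P Q c (seq P zero)     ≡⟨ agree (seq P zero) ⟩
  carry P Q c' (seq P zero)    ≡⟨ carry-sends P Q c' zero ⟩
  seq Q (orient c' zero)       ∎))
  where open ≡-Reasoning

Pairwise : ∀ {k} {X : Set} → (X → X → Set) → (Fin k → X) → Set
Pairwise R f = ∀ {i j} → i ≢ j → R (f i) (f j)

module Rigidity (G : Graph) {m k l}
  {A : Fin k → HamPath (suc (suc m))} {B : Fin l → HamPath (suc (suc m))}
  (distinctA : Pairwise Distinct A) (creatingA : Pairwise (Creating G) A)
  (distinctB : Pairwise Distinct B) (nonCreatingB : Pairwise (NonCreating G) B) where

  -- One relabelling cannot carry A a onto B b and A a' onto B b' unless
  -- a = a' and b = b': for a ≠ a' the images would be G-creating (so b = b',
  -- whence A a = A a'), and for a = a' the two images coincide.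
  carried-pairs-coincide : (σ : Fin (suc (suc m)) → Fin (suc (suc m))) (σ-inj : Inj σ) →
    ∀ {a b a' b'} →
    SamePath (relabel σ σ-inj (A a)) (B b) → SamePath (relabel σ σ-inj (A a')) (B b') →
    a ≡ a' × b ≡ b'
  carried-pairs-coincide σ σ-inj {a} {b} {a'} {b'} a↦b a'↦b' with a ≟ᶠ a' | b ≟ᶠ b'
  ... | yes refl | yes refl = refl , refl
  ... | yes refl | no b≢b' =
    ⊥-elim (distinctB b≢b'
      (same-trans (B b) (relabel σ σ-inj (A a)) (B b')
        (same-sym (relabel σ σ-inj (A a)) (B b) a↦b) a'↦b'))
  ... | no a≢a'  | yes refl =
    ⊥-elim (distinctA a≢a'
      (same-carried σ σ-inj {A a} {A a'} {B b} {B b} a↦b a'↦b' (same-refl {P = B b})))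
  ... | no a≢a'  | no b≢b' =
    ⊥-elim (nonCreatingB b≢b'
      (creating-carried G σ σ-inj {A a} {A a'} {B b} {B b'} a↦b a'↦b' (creatingA a≢a')))

  carry-determines-paths : ∀ {a b c a' b' c'} →
    carry (A a) (B b) c ≗ carry (A a') (B b') c' → a ≡ a' × b ≡ b'
  carry-determines-paths {a} {b} {c} {a'} {b'} {c'} agree =
    carried-pairs-coincide σ σ-inj
      (carried-onto {σ = σ} {σ-inj} (A a) (B b) c (λ _ → refl))
      (carried-onto {σ = σ} {σ-inj} (A a') (B b') c' agree)
    where
    σ = carry (A a) (B b) c
    σ-inj = carry-injective (A a) (B b) c

  carry-determines-triple : ∀ {a b c a' b' c'} →
    carry (A a) (B b) c ≗ carry (A a') (B b') c' → (a , b , c) ≡ (a' , b' , c')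
  carry-determines-triple {a} {b} {c} {a'} {b'} {c'} agree
    with carry-determines-paths {a} {b} {c} {a'} {b'} {c'} agree
  ... | refl , refl =
    cong (λ c → a , b , c) (carry-determines-orientation (A a) (B b) agree)

  triples-bound : k * (l * 2) ≤ suc (suc m) !
  triples-bound = triple-injection-bound encode encode-injective
    where
    encode : Fin k × Fin l × Fin 2 → Fin (suc (suc m) !)
    encode (a , b , c) = code (carry (A a) (B b) c) (carry-injective (A a) (B b) c)
    encode-injective : Injective _≡_ _≡_ encode
    encode-injective {a , b , c} {a' , b' , c'} eq = carry-determines-triple
      (code-injective (carry (A a) (B b) c) (carry (A a') (B b') c')
                      (carry-injective (A a) (B b) c) (carry-injective (A a') (B b') c') eq)

all-lookup : ∀ {X : Set} {P : X → Set} {xs : List X} → All P xs → ∀ i → P (lookup xs i)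
all-lookup (p ∷ _)  zero    = p
all-lookup (_ ∷ ps) (suc i) = all-lookup ps i

allPairs-lookup : ∀ {X : Set} {R : X → X → Set} → (∀ {x y} → R x y → R y x) →
  ∀ {xs : List X} → AllPairs R xs → Pairwise R (lookup xs)
allPairs-lookup R-sym (_ ∷ _)     {zero}  {zero}  0≢0 = ⊥-elim (0≢0 refl)
allPairs-lookup R-sym (heads ∷ _) {zero}  {suc j} _   = all-lookup heads j
allPairs-lookup R-sym (heads ∷ _) {suc i} {zero}  _   = R-sym (all-lookup heads i)
allPairs-lookup R-sym (_ ∷ rest)  {suc i} {suc j} i≢j =
  allPairs-lookup R-sym rest (i≢j ∘ cong suc)

lemma3p1 : (G : Graph) (n : ℕ) → 1 < n →
    (A B : List (HamPath n)) →
    AllPairs Distinct A → AllPairs (Creating G) A →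
    AllPairs Distinct B → AllPairs (NonCreating G) B →
    length A * length B ≤ (n !) / 2
lemma3p1 G (suc (suc m)) _ A B distinctA creatingA distinctB nonCreatingB =
  *-bound⇒≤/ {length A * length B} {suc (suc m) !} 2
    (subst (_≤ suc (suc m) !) (sym (*-assoc (length A) (length B) 2)) triples)
  where
  triples : length A * (length B * 2) ≤ suc (suc m) !
  triples = Rigidity.triples-bound G {A = lookup A} {B = lookup B}
    (allPairs-lookup (λ {P} {Q} → distinct-sym P Q) distinctA)
    (allPairs-lookup (λ {P} {Q} → creating-sym G P Q) creatingA)
    (allPairs-lookup (λ {P} {Q} → distinct-sym P Q) distinctB)
    (allPairs-lookup (λ {P} {Q} → nonCreating-sym G P Q) nonCreatingB)
lemma3p1 G (suc zero) (s≤s ())
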